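{- Let $S$ be a finite set of PLTL-clauses and let $T$ be the set of clauses obtained from $S$ by applying one simplification step or one subsumption step. Then the behaviour graph of $S$ is the same as the behaviour graph of $T$.
   Context: A literal is a proposition symbol or its negation. A PLTL-clause has one of the forms $\mathbf{start}\Rightarrow\bigvee_c l_c$ (initial clause), $\bigwedge_a k_a\Rightarrow\bigcirc\bigvee_d l_d$ (step clause), $\bigwedge_b k_b\Rightarrow\Diamond l$ (sometime clause), all $k,l$ literals ($\bigcirc$ = next, $\Diamond$ = sometime, $\mathbf{start}$ true only at the first moment). The literals $l$ on the right of sometime clauses are the eventuality literals. Simplification steps: $(l\wedge A\wedge l)\Rightarrow\bigcirc B$ becomes $(l\wedge A)\Rightarrow\bigcirc B$; $(l\wedge A\wedge\neg l)\Rightarrow\bigcirc B$ becomes $\mathbf{false}\Rightarrow\bigcirc B$; $(A\wedge\mathbf{true})\Rightarrow\bigcirc B$ becomes $A\Rightarrow\bigcirc B$; $(A\wedge\mathbf{false})\Rightarrow\bigcirc B$ becomes $\mathbf{false}\Rightarrow\bigcirc B$; $A\Rightarrow\bigcirc(l\vee B\vee l)$ becomes $A\Rightarrow\bigcirc(l\vee B)$; $A\Rightarrow\bigcirc(l\vee B\vee\neg l)$ becomes $A\Rightarrow\bigcirc\mathbf{true}$; $A\Rightarrow\bigcirc(B\vee\mathbf{true})$ becomes $A\Rightarrow\bigcirc\mathbf{true}$; $A\Rightarrow\bigcirc(B\vee\mathbf{false})$ becomes $A\Rightarrow\bigcirc B$; clauses $\mathbf{false}\Rightarrow\bigcirc A$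 and $A\Rightarrow\bigcirc\mathbf{true}$ are deleted. Analogous classical simplifications may be applied to initial clauses (replacing a clause by an equivalent one). Subsumption step: if the set contains $C\Rightarrow A$ and $D\Rightarrow B$ with $\vdash C\Rightarrow D$ and $\vdash B\Rightarrow A$, the clause $C\Rightarrow A$ is deleted. Behaviour graph of a clause set $S$: consider the directed graph whose nodes are all pairs $(V,E)$ with $V$ a valuation of the proposition symbols occurring in $S$ and $E$ a subset of the eventuality literals of $S$. For a node $(V,E)$, let $L$ be the set of right-hand sides (with $\bigcirc$ removed) of step clauses of $S$ whose left-hand sides are satisfied by $V$, and $E'$ the elements of $E$ not satisfied by $V$; for each valuation $V'$ satisfying all of $L$, with $E''$ the set of eventuality literals $l$ of sometime clauses $C\Rightarrow\Diamond l$ in $S$ whose $C$ is satisfied by $V'$, there is an edge $(V,E)\to(V',E'\cup E'')$, and no others leave $(V,E)$. A node $(V,E')$ is initial if $V$ satisfies the right-hand sides of all initial clauses of $S$ and $E'$ is the set of eventuality literals of sometime clauses whose left-hand sides $V$ satisfies. The behaviour graph is the subgraph induced by nodes reachable from initial nodes, with its initial nodes designated. -}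

module Defs where

open import Data.Nat using (ℕ)
open import Data.Fin using (Fin)
open import Data.Bool using (Bool; true; false; not; _∧_; _∨_)
open import Data.List using (List; []; _∷_)
open import Data.Maybe using (Maybe; just; nothing)
open import Data.Product using (_×_; ∃; ∃-syntax; Σ-syntax)
open import Data.Sum using (_⊎_)
open import Function.Bundles using (_⇔_)
open import Relation.Binary.PropositionalEquality using (_≡_)
open import Data.List.Membership.Propositional using (_∈_)
open import Data.List.Relation.Binary.Permutation.Propositional using (_↭_)

-- Syntax.  Proposition symbols are the elements of Fin n (a fixed finite
-- stock of symbols containing all those occurring in the clause sets).

data Lit (n : ℕ) : Set where
  pos : Fin n → Lit n
  neg : Fin n → Lit n

compl : ∀ {n} → Lit n → Lit n
compl (pos p) = neg p
compl (neg p) = pos p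

-- conjuncts / disjuncts: literals or the constants true / false
-- (the constants arise during simplification)
data Atom (n : ℕ) : Set where
  lit  : Lit n → Atom n
  tt   : Atom n
  ff   : Atom n

-- A conjunction (left-hand sides) or disjunction (right-hand sides)
-- is a list of atoms; [] is true as a conjunction, false as a disjunction.
data Clause (n : ℕ) : Set where
  initial  : List (Atom n) → Clause n                -- start ⇒ ⋁ A
  step     : List (Atom n) → List (Atom n) → Clause n -- ⋀ C ⇒ ○ ⋁ A
  sometime : List (Atom n) → Lit n → Clause n         -- ⋀ C ⇒ ◇ l

Valuation : ℕ → Set
Valuation n = Fin n → Bool

litSat : ∀ {n} → Valuation n → Lit n → Bool
litSat V (pos p) = V p
litSat V (neg p) = not (V p)

atomSat : ∀ {n} → Valuation n → Atom n → Bool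
atomSat V (lit l) = litSat V l
atomSat V tt = true
atomSat V ff = false

conj : ∀ {n} → Valuation n → List (Atom n) → Bool
conj V [] = true
conj V (a ∷ as) = atomSat V a ∧ conj V as

disj : ∀ {n} → Valuation n → List (Atom n) → Bool
disj V [] = false
disj V (a ∷ as) = atomSat V a ∨ disj V as

ConjEntails : ∀ {n} → List (Atom n) → List (Atom n) → Set
ConjEntails {n} C D = ∀ (V : Valuation n) → conj V C ≡ true → conj V D ≡ true

DisjEntails : ∀ {n} → List (Atom n) → List (Atom n) → Set
DisjEntails {n} B A = ∀ (V : Valuation n) → disj V B ≡ true → disj V A ≡ true

-- Simplification of a single clause: Simp c (just c') means c becomes c',
-- Simp c nothing means c is deleted.  Conjunctions / disjunctions are
-- taken up to reordering (associativity/commutativity), expressed by _↭_.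

data Simp {n : ℕ} : Clause n → Maybe (Clause n) → Set where
  lhs-dup    : ∀ {L B A} (l : Lit n) → L ↭ (lit l ∷ lit l ∷ A) →
               Simp (step L B) (just (step (lit l ∷ A) B))
  lhs-contra : ∀ {L B A} (l : Lit n) → L ↭ (lit l ∷ lit (compl l) ∷ A) →
               Simp (step L B) (just (step (ff ∷ []) B))
  lhs-true   : ∀ {L B A} → L ↭ (tt ∷ A) →
               Simp (step L B) (just (step A B))
  lhs-false  : ∀ {L B A} → L ↭ (ff ∷ A) →
               Simp (step L B) (just (step (ff ∷ []) B))
  rhs-dup    : ∀ {A R B} (l : Lit n) → R ↭ (lit l ∷ lit l ∷ B) →
               Simp (step A R) (just (step A (lit l ∷ B)))
  rhs-taut   : ∀ {A R B} (l : Lit n) → R ↭ (lit l ∷ lit (compl l) ∷ B) →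
               Simp (step A R) (just (step A (tt ∷ [])))
  rhs-true   : ∀ {A R B} → R ↭ (tt ∷ B) →
               Simp (step A R) (just (step A (tt ∷ [])))
  rhs-false  : ∀ {A R B} → R ↭ (ff ∷ B) →
               Simp (step A R) (just (step A B))
  del-false  : ∀ {A} → Simp (step (ff ∷ []) A) nothing
  del-true   : ∀ {A} → Simp (step A (tt ∷ [])) nothing
  init-equiv : ∀ {A A'} → (∀ (V : Valuation n) → disj V A ≡ disj V A') →
               Simp (initial A) (just (initial A'))
  init-valid : ∀ {A} → (∀ (V : Valuation n) → disj V A ≡ true) →
               Simp (initial A) nothing

data Subsumes {n : ℕ} : Clause n → Clause n → Set where
  step-sub : ∀ {C A D B} → ConjEntails C D → DisjEntails B A →
             Subsumes (step C A) (step D B)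
  init-sub : ∀ {A B} → DisjEntails B A → Subsumes (initial A) (initial B)
  some-sub : ∀ {C D l} → ConjEntails C D →
             Subsumes (sometime C l) (sometime D l)

-- T is obtained from S by one simplification step (clause sets as lists,
-- up to permutation)
data SimpStep {n : ℕ} (S T : List (Clause n)) : Set where
  replace : ∀ c c' R → S ↭ (c ∷ R) → Simp c (just c') → T ↭ (c' ∷ R) →
            SimpStep S T
  delete  : ∀ c R → S ↭ (c ∷ R) → Simp c nothing → T ↭ R → SimpStep S T

data SubsStep {n : ℕ} (S T : List (Clause n)) : Set where
  subsume : ∀ c d R → S ↭ (c ∷ d ∷ R) → Subsumes c d → T ↭ (d ∷ R) →
            SubsStep S T

-- Behaviour graph.  A node is a pair (V , E) with V a valuation and E a
-- set of literals (characteristic function), required to consist of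
-- eventuality literals of S.

Node : ℕ → Set
Node n = Valuation n × (Lit n → Bool)

open import Data.Product using (_,_)

IsEventuality : ∀ {n} → List (Clause n) → Lit n → Set
IsEventuality S l = ∃[ C ] (sometime C l ∈ S)

Triggered : ∀ {n} → List (Clause n) → Valuation n → Lit n → Set
Triggered S V l = ∃[ C ] (sometime C l ∈ S × conj V C ≡ true)

IsNode : ∀ {n} → List (Clause n) → Node n → Set
IsNode S (V , E) = ∀ l → E l ≡ true → IsEventuality S l

Initial : ∀ {n} → List (Clause n) → Node n → Set
Initial S (V , E) =
  IsNode S (V , E) ×
  (∀ A → initial A ∈ S → disj V A ≡ true) ×
  (∀ l → (E l ≡ true) ⇔ Triggered S V l)

Edge : ∀ {n} → List (Clause n) → Node n → Node n → Set
Edge S (V , E) (V' , F) =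
  IsNode S (V , E) × IsNode S (V' , F) ×
  (∀ C A → step C A ∈ S → conj V C ≡ true → disj V' A ≡ true) ×
  (∀ l → (F l ≡ true) ⇔
           ((E l ≡ true × litSat V l ≡ false) ⊎ Triggered S V' l))

data Reachable {n} (S : List (Clause n)) : Node n → Set where
  init : ∀ {x} → Initial S x → Reachable S x
  next : ∀ {x y} → Reachable S x → Edge S x y → Reachable S y

SameBehaviourGraph : ∀ {n} → List (Clause n) → List (Clause n) → Set
SameBehaviourGraph S T =
  (∀ x → Initial S x ⇔ Initial T x) ×
  (∀ x → Reachable S x ⇔ Reachable T x) ×
  (∀ x y → Reachable S x → Reachable S y → Edge S x y ⇔ Edge T x y)

{-# OPTIONS --safe #-}

-- The behaviour graph of a clause set S depends on S only through four
-- constraints: which literals are eventualities, which eventualities a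
-- valuation triggers, which valuations satisfy the initial clauses, and
-- which pairs of valuations satisfy the step clauses.  Deleting a clause
-- that is redundant for all four leaves them unchanged.  A subsumed clause
-- is redundant next to its subsumer, and a clause deleted by simplification
-- imposes nothing.  A simplification that rewrites a clause produces an
-- equivalent clause, i.e. one that subsumes it and is subsumed by it, so the
-- rewrite is the reverse of one subsumption step followed by another.

module Submission where

open import Defs
open import Data.Nat using (ℕ)
open import Data.Bool using (true; false; not; _∧_; _∨_)
open import Data.Bool.Properties
  using (∧-assoc; ∧-idem; ∧-inverseʳ; ∧-commutativeMonoid;
         ∨-assoc; ∨-idem; ∨-inverseʳ; ∨-commutativeMonoid; not-involutive)
open import Algebra.Bundles using (CommutativeMonoid)
open import Data.List using (List; _∷_)
open import Data.List.Membership.Propositional using (_∈_; find; lose)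
open import Data.List.Relation.Unary.All as All using (All; _∷_)
open import Data.List.Relation.Unary.Any using (Any; here; there)
open import Data.List.Relation.Binary.Permutation.Propositional
  using (_↭_; refl; prep; swap; trans; ↭-sym; ↭-refl; ↭-swap)
open import Data.List.Relation.Binary.Permutation.Propositional.Properties
  using (All-resp-↭; Any-resp-↭)
open import Data.Maybe using (just; nothing)
open import Data.Product using (_×_; _,_; ∃-syntax)
open import Data.Sum using (_⊎_; inj₁; inj₂)
open import Data.Sum.Function.Propositional using (_⊎-⇔_)
open import Function.Bundles using (_⇔_; mk⇔; Equivalence)
open import Function.Properties.Equivalence
  using () renaming (refl to ⇔-refl; sym to ⇔-sym; trans to ⇔-trans)
open import Relation.Binary.PropositionalEquality
  using (_≡_; refl; sym; cong) renaming (trans to ≡-trans)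
open import Algebra.Properties.CommutativeSemigroup
  (CommutativeMonoid.commutativeSemigroup ∧-commutativeMonoid)
  using () renaming (x∙yz≈y∙xz to ∧-swap)
open import Algebra.Properties.CommutativeSemigroup
  (CommutativeMonoid.commutativeSemigroup ∨-commutativeMonoid)
  using () renaming (x∙yz≈y∙xz to ∨-swap)

open Equivalence using (to)

module _ {a p} {A : Set a} {P : A → Set p} {x : A} {xs ys zs : List A} where

  All-delete : xs ↭ x ∷ zs → ys ↭ zs → (All P zs → P x) → All P xs ⇔ All P ys
  All-delete xs↭ ys↭ implied = mk⇔
    (λ all → All-resp-↭ (↭-sym ys↭) (All.tail (All-resp-↭ xs↭ all)))
    (λ all → let all′ = All-resp-↭ ys↭ all in All-resp-↭ (↭-sym xs↭) (implied all′ ∷ all′))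

  Any-delete : xs ↭ x ∷ zs → ys ↭ zs → (P x → Any P zs) → Any P xs ⇔ Any P ys
  Any-delete xs↭ ys↭ implied = mk⇔
    (λ any → Any-resp-↭ (↭-sym ys↭) (absorb (Any-resp-↭ xs↭ any)))
    (λ any → Any-resp-↭ (↭-sym xs↭) (there (Any-resp-↭ ys↭ any)))
    where
    absorb : Any P (x ∷ zs) → Any P zs
    absorb (here px) = implied px
    absorb (there any) = any

module _ {n : ℕ} where

  litSat-compl : ∀ (V : Valuation n) l → litSat V (compl l) ≡ not (litSat V l)
  litSat-compl V (pos p) = refl
  litSat-compl V (neg p) = sym (not-involutive (V p))

  conj-↭ : ∀ (V : Valuation n) {L L′} → L ↭ L′ → conj V L ≡ conj V L′
  conj-↭ V refl = refl
  conj-↭ V (prep a L↭) = cong (atomSat V a ∧_) (conj-↭ V L↭)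
  conj-↭ V (swap a b L↭) =
    ≡-trans (cong (λ rest → atomSat V a ∧ (atomSat V b ∧ rest)) (conj-↭ V L↭))
            (∧-swap (atomSat V a) (atomSat V b) _)
  conj-↭ V (trans L↭ L↭′) = ≡-trans (conj-↭ V L↭) (conj-↭ V L↭′)

  disj-↭ : ∀ (V : Valuation n) {L L′} → L ↭ L′ → disj V L ≡ disj V L′
  disj-↭ V refl = refl
  disj-↭ V (prep a L↭) = cong (atomSat V a ∨_) (disj-↭ V L↭)
  disj-↭ V (swap a b L↭) =
    ≡-trans (cong (λ rest → atomSat V a ∨ (atomSat V b ∨ rest)) (disj-↭ V L↭))
            (∨-swap (atomSat V a) (atomSat V b) _)
  disj-↭ V (trans L↭ L↭′) = ≡-trans (disj-↭ V L↭) (disj-↭ V L↭′)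

  conj-dup : ∀ (V : Valuation n) a L → conj V (a ∷ a ∷ L) ≡ conj V (a ∷ L)
  conj-dup V a L =
    ≡-trans (sym (∧-assoc (atomSat V a) _ _)) (cong (_∧ conj V L) (∧-idem (atomSat V a)))

  disj-dup : ∀ (V : Valuation n) a L → disj V (a ∷ a ∷ L) ≡ disj V (a ∷ L)
  disj-dup V a L =
    ≡-trans (sym (∨-assoc (atomSat V a) _ _)) (cong (_∨ disj V L) (∨-idem (atomSat V a)))

  conj-complementary : ∀ (V : Valuation n) l L → conj V (lit l ∷ lit (compl l) ∷ L) ≡ false
  conj-complementary V l L rewrite litSat-compl V l =
    ≡-trans (sym (∧-assoc (litSat V l) _ _)) (cong (_∧ conj V L) (∧-inverseʳ (litSat V l)))

  disj-complementary : ∀ (V : Valuation n) l L → disj V (lit l ∷ lit (compl l) ∷ L) ≡ true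
  disj-complementary V l L rewrite litSat-compl V l =
    ≡-trans (sym (∨-assoc (litSat V l) _ _)) (cong (_∨ disj V L) (∨-inverseʳ (litSat V l)))

  HasEventuality : Lit n → Clause n → Set
  HasEventuality l c = ∃[ C ] c ≡ sometime C l

  TriggeredBy : Valuation n → Lit n → Clause n → Set
  TriggeredBy V l c = ∃[ C ] (c ≡ sometime C l × conj V C ≡ true)

  InitialHolds : Valuation n → Clause n → Set
  InitialHolds V c = ∀ A → c ≡ initial A → disj V A ≡ true

  StepHolds : Valuation n → Valuation n → Clause n → Set
  StepHolds V V′ c = ∀ C A → c ≡ step C A → conj V C ≡ true → disj V′ A ≡ true

  InitialClausesHold : List (Clause n) → Valuation n → Set
  InitialClausesHold S V = ∀ A → initial A ∈ S → disj V A ≡ true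

  StepClausesHold : List (Clause n) → Valuation n → Valuation n → Set
  StepClausesHold S V V′ = ∀ C A → step C A ∈ S → conj V C ≡ true → disj V′ A ≡ true

  isEventuality⇔Any : ∀ S l → IsEventuality S l ⇔ Any (HasEventuality l) S
  isEventuality⇔Any S l = mk⇔ (λ (C , C∈S) → lose C∈S (C , refl)) (λ any → witness (find any))
    where
    witness : ∃[ c ] (c ∈ S × HasEventuality l c) → IsEventuality S l
    witness (_ , c∈S , C , refl) = C , c∈S

  triggered⇔Any : ∀ S V l → Triggered S V l ⇔ Any (TriggeredBy V l) S
  triggered⇔Any S V l =
    mk⇔ (λ (C , C∈S , sat) → lose C∈S (C , refl , sat)) (λ any → witness (find any))
    where
    witness : ∃[ c ] (c ∈ S × TriggeredBy V l c) → Triggered S V l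
    witness (_ , c∈S , C , refl , sat) = C , c∈S , sat

  initialClausesHold⇔All : ∀ S V → InitialClausesHold S V ⇔ All (InitialHolds V) S
  initialClausesHold⇔All S V = mk⇔
    (λ holds → All.tabulate λ { c∈S A refl → holds A c∈S })
    (λ all A A∈S → All.lookup all A∈S A refl)

  stepClausesHold⇔All : ∀ S V V′ → StepClausesHold S V V′ ⇔ All (StepHolds V V′) S
  stepClausesHold⇔All S V V′ = mk⇔
    (λ holds → All.tabulate λ { c∈S C A refl → holds C A c∈S })
    (λ all C A CA∈S → All.lookup all CA∈S C A refl)

  record SameConstraints (S T : List (Clause n)) : Set where
    field
      eventualities : ∀ l → IsEventuality S l ⇔ IsEventuality T l
      triggers      : ∀ V l → Triggered S V l ⇔ Triggered T V l
      initials      : ∀ V → InitialClausesHold S V ⇔ InitialClausesHold T V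
      steps         : ∀ V V′ → StepClausesHold S V V′ ⇔ StepClausesHold T V V′

  open SameConstraints

  SameConstraints-sym : ∀ {S T} → SameConstraints S T → SameConstraints T S
  SameConstraints-sym same = record
    { eventualities = λ l → ⇔-sym (eventualities same l)
    ; triggers      = λ V l → ⇔-sym (triggers same V l)
    ; initials      = λ V → ⇔-sym (initials same V)
    ; steps         = λ V V′ → ⇔-sym (steps same V V′)
    }

  SameConstraints-trans : ∀ {S T U} → SameConstraints S T → SameConstraints T U →
                          SameConstraints S U
  SameConstraints-trans same same′ = record
    { eventualities = λ l → ⇔-trans (eventualities same l) (eventualities same′ l)
    ; triggers      = λ V l → ⇔-trans (triggers same V l) (triggers same′ V l)
    ; initials      = λ V → ⇔-trans (initials same V) (initials same′ V)
    ; steps         = λ V V′ → ⇔-trans (steps same V V′) (steps same′ V V′)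
    }

  module _ {S T : List (Clause n)} (same : SameConstraints S T) where

    isNode-transport : ∀ x → IsNode S x → IsNode T x
    isNode-transport _ node l El = to (eventualities same l) (node l El)

    initial-transport : ∀ x → Initial S x → Initial T x
    initial-transport x@(V , _) (node , inits , E⇔) =
      isNode-transport x node , to (initials same V) inits ,
      λ l → ⇔-trans (E⇔ l) (triggers same V l)

    edge-transport : ∀ x y → Edge S x y → Edge T x y
    edge-transport x@(V , _) y@(V′ , _) (node , node′ , stepsHold , F⇔) =
      isNode-transport x node , isNode-transport y node′ , to (steps same V V′) stepsHold ,
      λ l → ⇔-trans (F⇔ l) (⇔-refl ⊎-⇔ triggers same V′ l)

    reachable-transport : ∀ {x} → Reachable S x → Reachable T x
    reachable-transport (init start) = init (initial-transport _ start)
    reachable-transport (next reach edge) = next (reachable-transport reach) (edge-transport _ _ edge)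

  sameBehaviourGraph : ∀ {S T} → SameConstraints S T → SameBehaviourGraph S T
  sameBehaviourGraph same =
    (λ x → mk⇔ (initial-transport same x) (initial-transport same⁻¹ x)) ,
    (λ x → mk⇔ (reachable-transport same) (reachable-transport same⁻¹)) ,
    (λ x y _ _ → mk⇔ (edge-transport same x y) (edge-transport same⁻¹ x y))
    where same⁻¹ = SameConstraints-sym same

  record Redundant (c : Clause n) (R : List (Clause n)) : Set where
    field
      eventualities : ∀ l → HasEventuality l c → Any (HasEventuality l) R
      triggers      : ∀ V l → TriggeredBy V l c → Any (TriggeredBy V l) R
      initials      : ∀ V → All (InitialHolds V) R → InitialHolds V c
      steps         : ∀ V V′ → All (StepHolds V V′) R → StepHolds V V′ c

  delete-redundant : ∀ {S T c R} → S ↭ c ∷ R → T ↭ R → Redundant c R → SameConstraints S T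
  delete-redundant {S} {T} S↭ T↭ redundant = record
    { eventualities = λ l → along (λ X → isEventuality⇔Any X l)
                                  (Any-delete S↭ T↭ (Redundant.eventualities redundant l))
    ; triggers      = λ V l → along (λ X → triggered⇔Any X V l)
                                    (Any-delete S↭ T↭ (Redundant.triggers redundant V l))
    ; initials      = λ V → along (λ X → initialClausesHold⇔All X V)
                                  (All-delete S↭ T↭ (Redundant.initials redundant V))
    ; steps         = λ V V′ → along (λ X → stepClausesHold⇔All X V V′)
                                     (All-delete S↭ T↭ (Redundant.steps redundant V V′))
    }
    where
    along : ∀ {F G : List (Clause n) → Set} → (∀ X → F X ⇔ G X) → G S ⇔ G T → F S ⇔ F T
    along F⇔G G⇔ = ⇔-trans (F⇔G S) (⇔-trans G⇔ (⇔-sym (F⇔G T)))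

  subsumed-redundant : ∀ {c d R} → Subsumes c d → d ∈ R → Redundant c R
  subsumed-redundant (step-sub C⇒D B⇒A) d∈R = record
    { eventualities = λ { _ (_ , ()) }
    ; triggers      = λ { _ _ (_ , () , _) }
    ; initials      = λ { _ _ _ () }
    ; steps         = λ { V V′ all _ _ refl satC →
                          B⇒A V′ (All.lookup all d∈R _ _ refl (C⇒D V satC)) }
    }
  subsumed-redundant (init-sub B⇒A) d∈R = record
    { eventualities = λ { _ (_ , ()) }
    ; triggers      = λ { _ _ (_ , () , _) }
    ; initials      = λ { V all _ refl → B⇒A V (All.lookup all d∈R _ refl) }
    ; steps         = λ { _ _ _ _ _ () }
    }
  subsumed-redundant (some-sub C⇒D) d∈R = record
    { eventualities = λ { _ (_ , refl) → lose d∈R (_ , refl) }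
    ; triggers      = λ { V _ (_ , refl , satC) → lose d∈R (_ , refl , C⇒D V satC) }
    ; initials      = λ { _ _ _ () }
    ; steps         = λ { _ _ _ _ _ () }
    }

  deletable-redundant : ∀ {c R} → Simp c nothing → Redundant c R
  deletable-redundant del-false = record
    { eventualities = λ { _ (_ , ()) }
    ; triggers      = λ { _ _ (_ , () , _) }
    ; initials      = λ { _ _ _ () }
    ; steps         = λ { _ _ _ _ _ refl () }
    }
  deletable-redundant del-true = record
    { eventualities = λ { _ (_ , ()) }
    ; triggers      = λ { _ _ (_ , () , _) }
    ; initials      = λ { _ _ _ () }
    ; steps         = λ { _ _ _ _ _ refl _ → refl }
    }
  deletable-redundant (init-valid valid) = record
    { eventualities = λ { _ (_ , ()) }
    ; triggers      = λ { _ _ (_ , () , _) }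
    ; initials      = λ { V _ _ refl → valid V }
    ; steps         = λ { _ _ _ _ _ () }
    }

  subsStep-sameConstraints : ∀ {S T} → SubsStep S T → SameConstraints S T
  subsStep-sameConstraints (subsume c d R S↭ c≼d T↭) =
    delete-redundant S↭ T↭ (subsumed-redundant c≼d (here refl))

  MutuallySubsume : Clause n → Clause n → Set
  MutuallySubsume c c′ = Subsumes c c′ × Subsumes c′ c

  equivalent-steps-mutuallySubsume :
    ∀ {C A C′ A′} → (∀ V → conj V C ≡ conj V C′) → (∀ V → disj V A ≡ disj V A′) →
    MutuallySubsume (step C A) (step C′ A′)
  equivalent-steps-mutuallySubsume C≡ A≡ =
    step-sub (λ V → ≡-trans (sym (C≡ V))) (λ V → ≡-trans (A≡ V)) ,
    step-sub (λ V → ≡-trans (C≡ V)) (λ V → ≡-trans (sym (A≡ V)))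

  simp-mutuallySubsume : ∀ {c c′} → Simp c (just c′) → MutuallySubsume c c′
  simp-mutuallySubsume (lhs-dup {A = A} l L↭) = equivalent-steps-mutuallySubsume
    (λ V → ≡-trans (conj-↭ V L↭) (conj-dup V (lit l) A)) (λ _ → refl)
  simp-mutuallySubsume (lhs-contra {A = A} l L↭) = equivalent-steps-mutuallySubsume
    (λ V → ≡-trans (conj-↭ V L↭) (conj-complementary V l A)) (λ _ → refl)
  simp-mutuallySubsume (lhs-true L↭) =
    equivalent-steps-mutuallySubsume (λ V → conj-↭ V L↭) (λ _ → refl)
  simp-mutuallySubsume (lhs-false L↭) =
    equivalent-steps-mutuallySubsume (λ V → conj-↭ V L↭) (λ _ → refl)
  simp-mutuallySubsume (rhs-dup {B = B} l R↭) = equivalent-steps-mutuallySubsume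
    (λ _ → refl) (λ V → ≡-trans (disj-↭ V R↭) (disj-dup V (lit l) B))
  simp-mutuallySubsume (rhs-taut {B = B} l R↭) = equivalent-steps-mutuallySubsume
    (λ _ → refl) (λ V → ≡-trans (disj-↭ V R↭) (disj-complementary V l B))
  simp-mutuallySubsume (rhs-true R↭) =
    equivalent-steps-mutuallySubsume (λ _ → refl) (λ V → disj-↭ V R↭)
  simp-mutuallySubsume (rhs-false R↭) =
    equivalent-steps-mutuallySubsume (λ _ → refl) (λ V → disj-↭ V R↭)
  simp-mutuallySubsume (init-equiv A≡) =
    init-sub (λ V → ≡-trans (A≡ V)) , init-sub (λ V → ≡-trans (sym (A≡ V)))

  replace-mutuallySubsuming : ∀ {S T c c′ R} → S ↭ c ∷ R → T ↭ c′ ∷ R →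
                              MutuallySubsume c c′ → SameConstraints S T
  replace-mutuallySubsuming {c = c} {c′} {R} S↭ T↭ (c≼c′ , c′≼c) =
    SameConstraints-trans
      (SameConstraints-sym (subsStep-sameConstraints (subsume c′ c R ↭-refl c′≼c S↭)))
      (subsStep-sameConstraints (subsume c c′ R (↭-swap c′ c ↭-refl) c≼c′ T↭))

  simpStep-sameConstraints : ∀ {S T} → SimpStep S T → SameConstraints S T
  simpStep-sameConstraints (replace _ _ _ S↭ simp T↭) =
    replace-mutuallySubsuming S↭ T↭ (simp-mutuallySubsume simp)
  simpStep-sameConstraints (delete _ _ S↭ simp T↭) =
    delete-redundant S↭ T↭ (deletable-redundant simp)

lemma9 : (n : ℕ) (S T : List (Clause n)) →
         (SimpStep S T ⊎ SubsStep S T) →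
         SameBehaviourGraph S T
lemma9 n S T (inj₁ simpStep) = sameBehaviourGraph (simpStep-sameConstraints simpStep)
lemma9 n S T (inj₂ subsStep) = sameBehaviourGraph (subsStep-sameConstraints subsStep)
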